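{- Let $X$ be a non-empty set of positive integers with $X\neq\{1\}$. Then there exists a non-empty set $Y$ of positive integers and a graph isomorphism $\phi:B(X)\to B(Y)$ which maps $\rho(X)$ onto $Y^*$ and $X^*$ onto $\rho(Y)$, and whose restrictions give graph isomorphisms $\Delta(X)\cong\Gamma(Y)$ and $\Gamma(X)\cong\Delta(Y)$.
   Context: For a non-empty set $X$ of positive integers, $\rho(X)$ is the set of primes dividing some element of $X$ and $X^*=X\setminus\{1\}$. The bipartite divisor graph $B(X)$ has vertex set the disjoint union $\rho(X)\cup X^*$, with edges $\{p,x\}$ for $p\in\rho(X)$, $x\in X^*$, $p\mid x$. The prime vertex graph $\Delta(X)$ has vertex set $\rho(X)$, with distinct primes $p,q$ adjacent iff $pq$ divides some $x\in X$. The common divisor graph $\Gamma(X)$ has vertex set $X^*$, with distinct $x,y$ adjacent iff $\gcd(x,y)>1$. -}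

module Defs where

open import Data.Nat using (ℕ; _<_; _*_)
open import Data.Nat.Divisibility using (_∣_)
open import Data.Nat.GCD using (gcd)
open import Data.Nat.Primality using (Prime)
open import Data.List using (List)
open import Data.List.Membership.Propositional using (_∈_)
open import Data.Sum using (_⊎_; inj₁; inj₂; [_,_])
open import Data.Product using (_×_; Σ; ∃; ∃-syntax)
open import Function using (id)
open import Data.Empty using (⊥)
open import Relation.Binary.PropositionalEquality using (_≡_; _≢_)
open import Relation.Nullary using (¬_)

-- A finite set X of positive integers is represented by a list
-- (duplicates/order are irrelevant: only membership is ever used).

InRho : List ℕ → ℕ → Set
InRho X p = Prime p × ∃[ x ] (x ∈ X × p ∣ x)

InStar : List ℕ → ℕ → Set
InStar X x = x ∈ X × x ≢ 1

InB : List ℕ → ℕ ⊎ ℕ → Set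
InB X (inj₁ p) = InRho X p
InB X (inj₂ x) = InStar X x

-- Edges of B(X): {p, x} with p ∣ x (vertex membership is handled by InB)
EdgeB : List ℕ → ℕ ⊎ ℕ → ℕ ⊎ ℕ → Set
EdgeB X (inj₁ p) (inj₁ q) = ⊥
EdgeB X (inj₁ p) (inj₂ x) = p ∣ x
EdgeB X (inj₂ x) (inj₁ p) = p ∣ x
EdgeB X (inj₂ x) (inj₂ y) = ⊥

EdgeΔ : List ℕ → ℕ → ℕ → Set
EdgeΔ X p q = p ≢ q × ∃[ x ] (x ∈ X × (p * q) ∣ x)

EdgeΓ : List ℕ → ℕ → ℕ → Set
EdgeΓ X x y = x ≢ y × 1 < gcd x y

record IsGraphIso {A B : Set}
                  (V₁ : A → Set) (E₁ : A → A → Set)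
                  (V₂ : B → Set) (E₂ : B → B → Set)
                  (f : A → B) : Set where
  field
    maps-into  : ∀ a → V₁ a → V₂ (f a)
    injective  : ∀ a a' → V₁ a → V₁ a' → f a ≡ f a' → a ≡ a'
    surjective : ∀ b → V₂ b → Σ A (λ a → V₁ a × f a ≡ b)
    edge-pres  : ∀ a a' → V₁ a → V₁ a' → E₁ a a' → E₂ (f a) (f a')
    edge-refl  : ∀ a a' → V₁ a → V₁ a' → E₂ (f a) (f a') → E₁ a a'

untag : ℕ ⊎ ℕ → ℕ
untag = [ id , id ]

IsLeft : ℕ ⊎ ℕ → Set
IsLeft v = ∃[ n ] (v ≡ inj₁ n)

IsRight : ℕ ⊎ ℕ → Set
IsRight v = ∃[ n ] (v ≡ inj₂ n)

-- Swap the roles of primes and numbers: give each x ∈ X its own prime q(x), and let each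
-- p ∈ ρ(X) become the number y(p) = (∏_{x ∈ X, p ∣ x} q(x))^(p+1). Then q(x) ∣ y(p) iff p ∣ x,
-- so B(X) ≅ B(Y) for Y = {y(p)}; the prime divisors of y(p) are exactly the q(x) with p ∣ x,
-- so two primes share a multiple in X iff their images have a common factor, and two numbers
-- of X share a prime iff their images divide a common element of Y.
module Submission where

open import Defs
open import Function using (_∘′_)
open import Data.List using (List; []; _∷_; map; filter; upTo)
open import Data.List.Extrema.Nat using (max; v≤max⁺)
open import Data.List.Membership.Propositional using (_∈_; find; lose)
open import Data.List.Membership.Propositional.Properties using (∈-map∘filter⁺; ∈-map∘filter⁻; ∈-upTo⁺)
open import Data.List.Relation.Unary.All using (All; _∷_; universal) renaming (lookup to All-lookup)
open import Data.List.Relation.Unary.All.Properties using (map⁺)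
open import Data.List.Relation.Unary.Any using (here; there; any?)
open import Data.Nat using (ℕ; zero; suc; _*_; _^_; _≤_; _<_; s≤s; z≤n; NonZero; _!; nonTrivial⇒n>1; ≢-nonZero; >-nonZero)
open import Data.Nat.Properties
open import Data.Nat.Divisibility
open import Data.Nat.GCD using (gcd; gcd[m,n]∣m; gcd[m,n]∣n; gcd[m,n]≢0; gcd-greatest)
open import Data.Nat.Coprimality using (Coprime; coprime-divisor)
open import Data.Nat.ListAction using (product)
open import Data.Nat.ListAction.Properties using (∈⇒∣product)
open import Data.Nat.Primality
open import Data.Nat.Primality.Factorisation using (factorise; factorisationHasAllPrimeFactors)
open import Data.Product using (_×_; _,_; proj₁; proj₂; Σ; ∃-syntax)
open import Data.Sum using (_⊎_; inj₁; inj₂)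
open import Data.Sum.Properties using (inj₁-injective; inj₂-injective)
open import Relation.Binary.Definitions using (tri<; tri≈; tri>)
open import Relation.Binary.PropositionalEquality
open import Relation.Nullary using (¬_; yes; no; contradiction)
open import Relation.Nullary.Decidable using (map′; _×-dec_)
open import Relation.Unary using (Decidable)

strictMono⇒injective : ∀ {f : ℕ → ℕ} → (∀ {m n} → m < n → f m < f n) →
                       ∀ {m n} → f m ≡ f n → m ≡ n
strictMono⇒injective mono {m} {n} fm≡fn with <-cmp m n
... | tri< m<n _ _ = contradiction fm≡fn (<⇒≢ (mono m<n))
... | tri≈ _ m≡n _ = m≡n
... | tri> _ _ n<m = contradiction fm≡fn (>⇒≢ (mono n<m))

step⇒strictMono : ∀ {f : ℕ → ℕ} → (∀ n → f n < f (suc n)) →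
                  ∀ {m n} → m < n → f m < f n
step⇒strictMono step {m} {suc n} m<1+n with m<1+n⇒m<n∨m≡n m<1+n
... | inj₁ m<n  = <-trans (step⇒strictMono step m<n) (step n)
... | inj₂ refl = step n

filter-cong : ∀ {A : Set} {P Q : A → Set} (P? : Decidable P) (Q? : Decidable Q) xs →
              (∀ {x} → x ∈ xs → P x → Q x) → (∀ {x} → x ∈ xs → Q x → P x) →
              filter P? xs ≡ filter Q? xs
filter-cong P? Q? [] _ _ = refl
filter-cong P? Q? (x ∷ xs) P⇒Q Q⇒P with P? x | Q? x
... | yes _  | yes _  = cong (x ∷_) (filter-cong P? Q? xs (P⇒Q ∘′ there) (Q⇒P ∘′ there))
... | no _   | no _   = filter-cong P? Q? xs (P⇒Q ∘′ there) (Q⇒P ∘′ there)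
... | yes px | no ¬qx = contradiction (P⇒Q (here refl) px) ¬qx
... | no ¬px | yes qx = contradiction (Q⇒P (here refl) qx) ¬px

prime⇒1< : ∀ {p} → Prime p → 1 < p
prime⇒1< {p} pp = nonTrivial⇒n>1 p {{prime⇒nonTrivial pp}}

prime∤1 : ∀ {p} → Prime p → ¬ p ∣ 1
prime∤1 pp p∣1 = ¬prime[1] (subst Prime (∣1⇒≡1 p∣1) pp)

∃prime∣ : ∀ {n} → 1 < n → ∃[ p ] Prime p × p ∣ n
∃prime∣ {n@(suc _)} 1<n with factorise n
... | record { factors = [] ; isFactorisation = n≡1 } = contradiction n≡1 (>⇒≢ 1<n)
... | record { factors = p ∷ ps ; isFactorisation = n≡∏ ; factorsPrime = pp ∷ _ } =
  p , pp , subst (p ∣_) (sym n≡∏) (∈⇒∣product {ns = p ∷ ps} (here refl))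

m∣m! : ∀ m .{{_ : NonZero m}} → m ∣ m !
m∣m! (suc m) = m∣m*n (m !)

-- Euclid: a prime factor p of n! + 1 exceeds n, as otherwise p ∣ n! and hence p ∣ 1.
∃prime> : ∀ n → ∃[ p ] Prime p × n < p
∃prime> n with ∃prime∣ {suc (n !)} (s≤s (1≤n! n))
... | p , pp , p∣1+n! = p , pp , ≰⇒> p≰n
  where
  p≰n : ¬ p ≤ n
  p≰n p≤n = prime∤1 pp (∣m+n∣m⇒∣n (subst (p ∣_) (+-comm 1 (n !)) p∣1+n!)
                                   (∣-trans (m∣m! p {{prime⇒nonZero pp}}) (m≤n⇒m!∣n! p≤n)))

primeSeq : ℕ → ℕ
primeSeq zero    = 2
primeSeq (suc k) = proj₁ (∃prime> (primeSeq k))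

primeSeq-prime : ∀ k → Prime (primeSeq k)
primeSeq-prime zero    = prime[2]
primeSeq-prime (suc k) = proj₁ (proj₂ (∃prime> (primeSeq k)))

primeSeq-injective : ∀ {k l} → primeSeq k ≡ primeSeq l → k ≡ l
primeSeq-injective = strictMono⇒injective (step⇒strictMono primeSeq-step)
  where
  primeSeq-step : ∀ k → primeSeq k < primeSeq (suc k)
  primeSeq-step k = proj₂ (proj₂ (∃prime> (primeSeq k)))

prime∣m^n⇒prime∣m : ∀ {p m} n → Prime p → p ∣ m ^ n → p ∣ m
prime∣m^n⇒prime∣m zero    pp p∣1 = contradiction p∣1 (prime∤1 pp)
prime∣m^n⇒prime∣m {m = m} (suc n) pp p∣m*m^n with euclidsLemma m (m ^ n) pp p∣m*m^n
... | inj₁ p∣m   = p∣m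
... | inj₂ p∣m^n = prime∣m^n⇒prime∣m n pp p∣m^n

distinctPrimes⇒coprime : ∀ {p q} → Prime p → Prime q → p ≢ q → Coprime p q
distinctPrimes⇒coprime pp pq p≢q (d∣p , d∣q)
  with prime⇒irreducible pp d∣p | prime⇒irreducible pq d∣q
... | inj₁ d≡1  | _         = d≡1
... | inj₂ _    | inj₁ d≡1  = d≡1
... | inj₂ refl | inj₂ p≡q  = contradiction p≡q p≢q

distinctPrimes∣⇒*∣ : ∀ {p q n} → Prime p → Prime q → p ≢ q → p ∣ n → q ∣ n → p * q ∣ n
distinctPrimes∣⇒*∣ {p} {q} pp pq p≢q p∣k*q (divides k refl) = *-pres-∣ p∣k (∣-refl {q})
  where
  p∣k : p ∣ k
  p∣k = coprime-divisor (distinctPrimes⇒coprime pp pq p≢q) (subst (p ∣_) (*-comm k q) p∣k*q)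

commonPrimeDivisor⇒1<gcd : ∀ {p m n} → Prime p → p ∣ m → p ∣ n → 0 < m → 1 < gcd m n
commonPrimeDivisor⇒1<gcd {p} {m} {n} pp p∣m p∣n 0<m =
  <-≤-trans (prime⇒1< pp) (∣⇒≤ {{gcd≢0}} (gcd-greatest p∣m p∣n))
  where
  gcd≢0 : NonZero (gcd m n)
  gcd≢0 = ≢-nonZero (gcd[m,n]≢0 m n (inj₁ (>⇒≢ 0<m)))

1<gcd⇒commonPrimeDivisor : ∀ {m n} → 1 < gcd m n → ∃[ p ] Prime p × p ∣ m × p ∣ n
1<gcd⇒commonPrimeDivisor {m} {n} 1<gcd with ∃prime∣ 1<gcd
... | p , pp , p∣gcd = p , pp , ∣-trans p∣gcd (gcd[m,n]∣m m n) , ∣-trans p∣gcd (gcd[m,n]∣n m n)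

swapSides : (ℕ → ℕ) → (ℕ → ℕ) → ℕ ⊎ ℕ → ℕ ⊎ ℕ
swapSides f g (inj₁ p) = inj₂ (f p)
swapSides f g (inj₂ x) = inj₁ (g x)

-- Edges of B join a prime to a number, so a side-swapping vertex bijection is
-- an isomorphism of B as soon as it preserves and reflects divisibility.
swapSides-isGraphIso :
  ∀ {X Y f g} {E₁ E₂ E₃ E₄ : ℕ → ℕ → Set} →
  IsGraphIso (InRho X) E₁ (InStar Y) E₂ f →
  IsGraphIso (InStar X) E₃ (InRho Y) E₄ g →
  (∀ {p x} → InRho X p → InStar X x → p ∣ x → g x ∣ f p) →
  (∀ {p x} → InRho X p → InStar X x → g x ∣ f p → p ∣ x) →
  IsGraphIso (InB X) (EdgeB X) (InB Y) (EdgeB Y) (swapSides f g)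
swapSides-isGraphIso {X} {Y} {f} {g} isoF isoG ∣⇒∣ ∣⇒∣⁻¹ = record
  { maps-into  = λ { (inj₁ p) → F.maps-into p ; (inj₂ x) → G.maps-into x }
  ; injective  = injective
  ; surjective = surjective
  ; edge-pres  = edge-pres
  ; edge-refl  = edge-refl
  }
  where
  module F = IsGraphIso isoF
  module G = IsGraphIso isoG
  φ = swapSides f g

  injective : ∀ a b → InB X a → InB X b → φ a ≡ φ b → a ≡ b
  injective (inj₁ p) (inj₁ q) ρp ρq eq = cong inj₁ (F.injective p q ρp ρq (inj₂-injective eq))
  injective (inj₂ x) (inj₂ y) x* y* eq = cong inj₂ (G.injective x y x* y* (inj₁-injective eq))

  surjective : ∀ b → InB Y b → Σ (ℕ ⊎ ℕ) λ a → InB X a × φ a ≡ b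
  surjective (inj₁ r) ρr with G.surjective r ρr
  ... | x , x* , gx≡r = inj₂ x , x* , cong inj₁ gx≡r
  surjective (inj₂ y) y* with F.surjective y y*
  ... | p , ρp , fp≡y = inj₁ p , ρp , cong inj₂ fp≡y

  edge-pres : ∀ a b → InB X a → InB X b → EdgeB X a b → EdgeB Y (φ a) (φ b)
  edge-pres (inj₁ p) (inj₂ x) ρp x* = ∣⇒∣ ρp x*
  edge-pres (inj₂ x) (inj₁ p) x* ρp = ∣⇒∣ ρp x*

  edge-refl : ∀ a b → InB X a → InB X b → EdgeB Y (φ a) (φ b) → EdgeB X a b
  edge-refl (inj₁ p) (inj₂ x) ρp x* = ∣⇒∣⁻¹ ρp x*
  edge-refl (inj₂ x) (inj₁ p) x* ρp = ∣⇒∣⁻¹ ρp x*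

module Dual (X : List ℕ) (X⁺ : All (0 <_) X) where

  base : ℕ → ℕ
  base p = product (map primeSeq (filter (p ∣?_) X))

  -- Primes p ≠ p′ dividing the same elements of X have the same base; the exponent tells them apart.
  dual : ℕ → ℕ
  dual p = base p ^ suc p

  base≢0 : ∀ p → NonZero (base p)
  base≢0 p = productOfPrimes≢0 (map⁺ {xs = filter (p ∣?_) X} (universal primeSeq-prime _))

  dual-pos : ∀ p → 0 < dual p
  dual-pos p = m^n>0 (base p) {{base≢0 p}} (suc p)

  primeSeq∣base : ∀ {x p} → x ∈ X → p ∣ x → primeSeq x ∣ base p
  primeSeq∣base {x} {p} x∈X p∣x =
    ∈⇒∣product {ns = map primeSeq (filter (p ∣?_) X)}
               (∈-map∘filter⁺ primeSeq (p ∣?_) (x , x∈X , refl , p∣x))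

  primeSeq∣dual : ∀ {x p} → x ∈ X → p ∣ x → primeSeq x ∣ dual p
  primeSeq∣dual {p = p} x∈X p∣x = ∣-trans (primeSeq∣base x∈X p∣x) (m∣m*n (base p ^ p))

  prime∣dual : ∀ {r p} → Prime r → r ∣ dual p → ∃[ x ] x ∈ X × p ∣ x × r ≡ primeSeq x
  prime∣dual {r} {p} pr r∣dual
    with ∈-map∘filter⁻ primeSeq (p ∣?_)
           (factorisationHasAllPrimeFactors pr (prime∣m^n⇒prime∣m (suc p) pr r∣dual)
                                            (map⁺ (universal primeSeq-prime _)))
  ... | x , x∈X , r≡qx , p∣x = x , x∈X , p∣x , r≡qx

  primeSeq∣dual⁻¹ : ∀ {x p} → primeSeq x ∣ dual p → x ∈ X × p ∣ x
  primeSeq∣dual⁻¹ {x} qx∣dual with prime∣dual (primeSeq-prime x) qx∣dual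
  ... | x′ , x′∈X , p∣x′ , qx≡qx′ with primeSeq-injective {x} {x′} qx≡qx′
  ... | refl = x′∈X , p∣x′

  dual≢1 : ∀ {p} → InRho X p → dual p ≢ 1
  dual≢1 (_ , x , x∈X , p∣x) dual≡1 =
    prime∤1 (primeSeq-prime x) (subst (primeSeq x ∣_) dual≡1 (primeSeq∣dual x∈X p∣x))

  dual-injective : ∀ {p p′} → InRho X p → InRho X p′ → dual p ≡ dual p′ → p ≡ p′
  dual-injective {p} {p′} (_ , x , x∈X , p∣x) _ dual≡ =
    suc-injective (strictMono⇒injective (^-monoʳ-< (base p) 1<base) dualp≡)
    where
    transfer : ∀ {a b} → dual a ≡ dual b → ∀ {y} → y ∈ X → a ∣ y → b ∣ y
    transfer eq {y} y∈X a∣y =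
      proj₂ (primeSeq∣dual⁻¹ (subst (primeSeq y ∣_) eq (primeSeq∣dual y∈X a∣y)))

    base≡ : base p ≡ base p′
    base≡ = cong (λ xs → product (map primeSeq xs))
                 (filter-cong (p ∣?_) (p′ ∣?_) X (transfer dual≡) (transfer (sym dual≡)))

    1<base : 1 < base p
    1<base = <-≤-trans (prime⇒1< (primeSeq-prime x))
                       (∣⇒≤ {{base≢0 p}} (primeSeq∣base x∈X p∣x))

    dualp≡ : base p ^ suc p ≡ base p ^ suc p′
    dualp≡ = trans dual≡ (cong (_^ suc p′) (sym base≡))

  InRho? : Decidable (InRho X)
  InRho? p = prime? p ×-dec map′ find (λ (_ , x∈X , p∣x) → lose x∈X p∣x) (any? (p ∣?_) X)

  bound : ℕ
  bound = suc (max 0 X)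

  -- 1 only makes Y non-empty; it is not a vertex of B(Y).
  Y : List ℕ
  Y = 1 ∷ map dual (filter InRho? (upTo bound))

  Y⁺ : All (0 <_) Y
  Y⁺ = s≤s z≤n ∷ map⁺ (universal dual-pos _)

  dual∈Y : ∀ {p} → InRho X p → dual p ∈ Y
  dual∈Y {p} ρp@(_ , x , x∈X , p∣x) =
    there (∈-map∘filter⁺ dual InRho? (p , ∈-upTo⁺ (s≤s p≤max) , refl , ρp))
    where
    p≤max : p ≤ max 0 X
    p≤max = v≤max⁺ 0 X (inj₂ (lose x∈X (∣⇒≤ {{>-nonZero (All-lookup X⁺ x∈X)}} p∣x)))

  ∈Y⁻ : ∀ {y} → y ∈ Y → y ≡ 1 ⊎ ∃[ p ] InRho X p × y ≡ dual p
  ∈Y⁻ (here y≡1) = inj₁ y≡1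
  ∈Y⁻ (there y∈) with ∈-map∘filter⁻ dual InRho? {xs = upTo bound} y∈
  ... | p , _ , y≡dual , ρp = inj₂ (p , ρp , y≡dual)

  InStarY⁻ : ∀ {y} → InStar Y y → Σ ℕ λ p → InRho X p × dual p ≡ y
  InStarY⁻ (y∈Y , y≢1) with ∈Y⁻ y∈Y
  ... | inj₁ y≡1             = contradiction y≡1 y≢1
  ... | inj₂ (p , ρp , y≡dual) = p , ρp , sym y≡dual

  primeSeq∈ρY : ∀ {x} → InStar X x → InRho Y (primeSeq x)
  primeSeq∈ρY {x} (x∈X , x≢1) with ∃prime∣ (≤∧≢⇒< (All-lookup X⁺ x∈X) (≢-sym x≢1))
  ... | p , pp , p∣x =
    primeSeq-prime x , dual p , dual∈Y (pp , x , x∈X , p∣x) , primeSeq∣dual x∈X p∣x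

  InRhoY⁻ : ∀ {r} → InRho Y r → Σ ℕ λ x → InStar X x × primeSeq x ≡ r
  InRhoY⁻ {r} (pr , y , y∈Y , r∣y) with ∈Y⁻ y∈Y
  ... | inj₁ refl = contradiction r∣y (prime∤1 pr)
  ... | inj₂ (p , (pp , _) , refl) with prime∣dual pr r∣y
  ...   | x , x∈X , p∣x , r≡qx = x , (x∈X , λ { refl → prime∤1 pp p∣x }) , sym r≡qx

  isoΔΓ : IsGraphIso (InRho X) (EdgeΔ X) (InStar Y) (EdgeΓ Y) dual
  isoΔΓ = record
    { maps-into  = λ _ ρp → dual∈Y ρp , dual≢1 ρp
    ; injective  = λ _ _ → dual-injective
    ; surjective = λ _ → InStarY⁻
    ; edge-pres  = edge-pres
    ; edge-refl  = edge-refl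
    }
    where
    edge-pres : ∀ p p′ → InRho X p → InRho X p′ → EdgeΔ X p p′ → EdgeΓ Y (dual p) (dual p′)
    edge-pres p p′ ρp ρp′ (p≢p′ , x , x∈X , pp′∣x) =
      p≢p′ ∘′ dual-injective ρp ρp′ ,
      commonPrimeDivisor⇒1<gcd (primeSeq-prime x) (primeSeq∣dual x∈X (∣-trans (m∣m*n p′) pp′∣x))
                                (primeSeq∣dual x∈X (∣-trans (n∣m*n p) pp′∣x)) (dual-pos p)

    edge-refl : ∀ p p′ → InRho X p → InRho X p′ → EdgeΓ Y (dual p) (dual p′) → EdgeΔ X p p′
    edge-refl p p′ (pp , _) (pp′ , _) (dual≢ , 1<gcd) with 1<gcd⇒commonPrimeDivisor 1<gcd
    ... | r , pr , r∣dual , r∣dual′ with prime∣dual pr r∣dual | prime∣dual pr r∣dual′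
    ... | x , x∈X , p∣x , r≡qx | x′ , _ , p′∣x′ , r≡qx′
      with primeSeq-injective {x} {x′} (trans (sym r≡qx) r≡qx′)
    ... | refl = p≢p′ , x , x∈X , distinctPrimes∣⇒*∣ pp pp′ p≢p′ p∣x p′∣x′
      where
      p≢p′ : p ≢ p′
      p≢p′ refl = dual≢ refl

  isoΓΔ : IsGraphIso (InStar X) (EdgeΓ X) (InRho Y) (EdgeΔ Y) primeSeq
  isoΓΔ = record
    { maps-into  = λ _ → primeSeq∈ρY
    ; injective  = λ _ _ _ _ → primeSeq-injective
    ; surjective = λ _ → InRhoY⁻
    ; edge-pres  = edge-pres
    ; edge-refl  = edge-refl
    }
    where
    edge-pres : ∀ x x′ → InStar X x → InStar X x′ → EdgeΓ X x x′ → EdgeΔ Y (primeSeq x) (primeSeq x′)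
    edge-pres x x′ (x∈X , _) (x′∈X , _) (x≢x′ , 1<gcd) with 1<gcd⇒commonPrimeDivisor 1<gcd
    ... | p , pp , p∣x , p∣x′ =
      qx≢qx′ , dual p , dual∈Y (pp , x , x∈X , p∣x) ,
      distinctPrimes∣⇒*∣ (primeSeq-prime x) (primeSeq-prime x′) qx≢qx′
                         (primeSeq∣dual x∈X p∣x) (primeSeq∣dual x′∈X p∣x′)
      where
      qx≢qx′ : primeSeq x ≢ primeSeq x′
      qx≢qx′ = x≢x′ ∘′ primeSeq-injective

    edge-refl : ∀ x x′ → InStar X x → InStar X x′ → EdgeΔ Y (primeSeq x) (primeSeq x′) → EdgeΓ X x x′
    edge-refl x x′ (x∈X , _) _ (qx≢qx′ , y , y∈Y , qxqx′∣y) with ∈Y⁻ y∈Y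
    ... | inj₁ refl = contradiction (∣-trans (m∣m*n (primeSeq x′)) qxqx′∣y) (prime∤1 (primeSeq-prime x))
    ... | inj₂ (p , (pp , _) , refl) =
      (λ { refl → qx≢qx′ refl }) ,
      commonPrimeDivisor⇒1<gcd pp (proj₂ (primeSeq∣dual⁻¹ (∣-trans (m∣m*n (primeSeq x′)) qxqx′∣y)))
                                  (proj₂ (primeSeq∣dual⁻¹ (∣-trans (n∣m*n (primeSeq x)) qxqx′∣y)))
                                  (All-lookup X⁺ x∈X)

corollary2p1 :
    (X : List ℕ) → All (0 <_) X → X ≢ [] → ¬ (∀ x → x ∈ X → x ≡ 1) →
    Σ (List ℕ) λ Y → All (0 <_) Y × Y ≢ [] ×
      Σ (ℕ ⊎ ℕ → ℕ ⊎ ℕ) λ φ →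
        IsGraphIso (InB X) (EdgeB X) (InB Y) (EdgeB Y) φ
        × (∀ p → InRho X p → IsRight (φ (inj₁ p)))
        × (∀ x → InStar X x → IsLeft (φ (inj₂ x)))
        × IsGraphIso (InRho X) (EdgeΔ X) (InStar Y) (EdgeΓ Y) (λ p → untag (φ (inj₁ p)))
        × IsGraphIso (InStar X) (EdgeΓ X) (InRho Y) (EdgeΔ Y) (λ x → untag (φ (inj₂ x)))
corollary2p1 X X⁺ _ _ =
  Y , Y⁺ , (λ ()) , swapSides dual primeSeq ,
  swapSides-isGraphIso isoΔΓ isoΓΔ (λ _ (x∈X , _) → primeSeq∣dual x∈X)
                                   (λ _ _ → proj₂ ∘′ primeSeq∣dual⁻¹) ,
  (λ p _ → dual p , refl) , (λ x _ → primeSeq x , refl) , isoΔΓ , isoΓΔ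
  where open Dual X X⁺
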